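{- Let $\mathbf{u}$ be an aperiodic uniformly recurrent infinite binary word whose set of factors contains infinitely many antipalindromes. Then the set of factors of $\mathbf{u}$ contains infinitely many antipalindromes that are bispecial factors.
   Context: $\mathrm{E}(w_1\cdots w_n)=(1-w_n)\cdots(1-w_1)$; antipalindrome: $\mathrm{E}(w)=w$. Aperiodic: not of the form $vw^\infty$ with $w$ nonempty. Uniformly recurrent: for each $n$ there is $r(n)$ such that every factor of length $r(n)$ contains all factors of length $n$. A factor $w$ of $\mathbf{u}$ is right special if $w0$ and $w1$ are both factors, left special if $0w$ and $1w$ are both factors, and bispecial if both. -}

module Defs where

open import Data.Bool using (Bool; true; false; not)
open import Data.Nat using (ℕ; zero; suc; _+_; _≤_; _<_)
open import Data.List using (List; []; _∷_; reverse; map; length; [_]; _++_)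
open import Data.Product using (Σ; ∃; ∃-syntax; _×_; _,_)
open import Relation.Binary.PropositionalEquality using (_≡_)
open import Relation.Nullary using (¬_)

-- An infinite binary word, letters 0 = false, 1 = true.
InfWord : Set
InfWord = ℕ → Bool

Word : Set
Word = List Bool

window : InfWord → ℕ → ℕ → Word
window u i zero    = []
window u i (suc n) = u i ∷ window u (suc i) n

IsFactor : InfWord → Word → Set
IsFactor u w = ∃[ i ] window u i (length w) ≡ w

E : Word → Word
E w = map not (reverse w)

IsAntipalindrome : Word → Set
IsAntipalindrome w = E w ≡ w

-- eventually periodic: u = v w^∞ with w nonempty
EventuallyPeriodic : InfWord → Set
EventuallyPeriodic u = ∃[ p ] ∃[ N ] (0 < p × (∀ n → N ≤ n → u (n + p) ≡ u n))

Aperiodic : InfWord → Set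
Aperiodic u = ¬ EventuallyPeriodic u

OccursIn : InfWord → Word → ℕ → ℕ → Set
OccursIn u w i r = ∃[ j ] (i ≤ j × j + length w ≤ i + r × window u j (length w) ≡ w)

UniformlyRecurrent : InfWord → Set
UniformlyRecurrent u =
  ∀ n → ∃[ r ] (∀ i (w : Word) → length w ≡ n → IsFactor u w → OccursIn u w i r)

RightSpecial : InfWord → Word → Set
RightSpecial u w = IsFactor u (w ++ [ false ]) × IsFactor u (w ++ [ true ])

LeftSpecial : InfWord → Word → Set
LeftSpecial u w = IsFactor u (false ∷ w) × IsFactor u (true ∷ w)

Bispecial : InfWord → Word → Set
Bispecial u w = RightSpecial u w × LeftSpecial u w

-- a set P of finite binary words is infinite iff it contains words of unbounded length
-- (there are only finitely many binary words of each length)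
InfinitelyMany : (Word → Set) → Set
InfinitelyMany P = ∀ m → ∃[ w ] (m ≤ length w × P w)

module Submission where

-- Write an antipalindromic window of u letterwise: u[s..s+n) is an
-- antipalindrome iff u(s+a) = ¬u(s+b) whenever a + b + 1 = n, i.e. it is a reflection
-- of the word about the centre of the window; in particular it has even length 2h.
--
-- Every factor v lies inside some antipalindromic factor (uniform
--    recurrence plus long antipalindromes), and reflecting v inside it shows that
--    E(v) is a factor.
--  * Extension.  An antipalindrome u[s..s+2h) is pushed to the left while the two
--    flanking letters are complementary.  Either it stops at a "flanked" antipalindrome
--    w with u(s'-1) = u(s'+|w|) = x, which is bispecial since xw, wx and, by
--    E-closure, E(wx) = x̄w and E(xw) = wx̄ are factors; or it reaches position 0, so
--    u has an antipalindromic prefix with the same centre.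
--  * Periodicity.  Two antipalindromic prefixes with centres H < H + d compose to a
--    translation by 2d; if the shorter prefix contains every factor of length 2d + 1,
--    uniform recurrence spreads the period 2d to all of u.
-- Applying the extension to two nearby occurrences, far from the origin, of a long
-- antipalindrome, the second alternative for both would make u periodic; hence a long
-- flanked antipalindrome exists, which is the required bispecial antipalindrome.

open import Defs
open import Data.Bool using (Bool; true; false; not)
open import Data.Bool.Properties using (not-¬; ¬-not) renaming (_≟_ to _≟ᴮ_)
open import Data.Nat using (ℕ; zero; suc; _+_; _≤_; _<_; z≤n; s≤s)
open import Data.Nat.Properties
open import Data.Nat.Tactic.RingSolver using (solve-∀)
open import Data.List using (_∷_; reverse; map; length; [_]; _++_)
open import Data.List.Properties using (∷-injectiveˡ; ∷-injectiveʳ; ∷ʳ-injective; unfold-reverse; reverse-++; map-++)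
open import Data.Product using (∃-syntax; _×_; _,_; proj₁; proj₂)
open import Data.Sum using (_⊎_; inj₁; inj₂)
open import Data.Empty using (⊥-elim)
open import Relation.Nullary using (yes; no)
open import Relation.Binary.PropositionalEquality using (_≡_; _≢_; refl; sym; trans; cong; cong₂; subst; module ≡-Reasoning)

length-window : ∀ u s n → length (window u s n) ≡ n
length-window u s zero    = refl
length-window u s (suc n) = cong suc (length-window u (suc s) n)

window-factor : ∀ u s n → IsFactor u (window u s n)
window-factor u s n = s , cong (window u s) (length-window u s n)

window-snoc : ∀ u s n → window u s (suc n) ≡ window u s n ++ [ u (s + n) ]
window-snoc u s zero    = cong (λ i → [ u i ]) (sym (+-identityʳ s))
window-snoc u s (suc n) = cong (u s ∷_)
  (trans (window-snoc u (suc s) n) (cong (λ i → window u (suc s) n ++ [ u i ]) (sym (+-suc s n))))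

window-≡⇒agree : ∀ u i j n → window u i n ≡ window u j n → ∀ t → t < n → u (i + t) ≡ u (j + t)
window-≡⇒agree u i j (suc n) eq zero _ =
  trans (cong u (+-identityʳ i)) (trans (∷-injectiveˡ eq) (cong u (sym (+-identityʳ j))))
window-≡⇒agree u i j (suc n) eq (suc t) (s≤s t<n) =
  trans (cong u (+-suc i t))
    (trans (window-≡⇒agree u (suc i) (suc j) n (∷-injectiveʳ eq) t t<n) (cong u (sym (+-suc j t))))

E-cons : ∀ x w → E (x ∷ w) ≡ E w ++ [ not x ]
E-cons x w = trans (cong (map not) (unfold-reverse x w)) (map-++ not (reverse w) [ x ])

E-snoc : ∀ w x → E (w ++ [ x ]) ≡ not x ∷ E w
E-snoc w x = cong (map not) (reverse-++ w [ x ])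

-- Reflections.  The window of length n at j is the letterwise exchange-image of the one
-- at s: its a-th letter is the complement of the b-th letter of the other when a+b+1 = n.
Reflected : InfWord → ℕ → ℕ → ℕ → Set
Reflected u s j n = ∀ a b → a + suc b ≡ n → u (j + a) ≡ not (u (s + b))

AntipalAt : InfWord → ℕ → ℕ → Set
AntipalAt u s n = Reflected u s s n

reflected⇒E : ∀ u s j n → Reflected u s j n → E (window u s n) ≡ window u j n
reflected⇒E u s j zero    _   = refl
reflected⇒E u s j (suc n) ref = begin
  E (u s ∷ window u (suc s) n)             ≡⟨ E-cons (u s) (window u (suc s) n) ⟩
  E (window u (suc s) n) ++ [ not (u s) ]  ≡⟨ cong₂ (λ w x → w ++ [ x ]) (reflected⇒E u (suc s) j n inner) last ⟩
  window u j n ++ [ u (j + n) ]            ≡⟨ sym (window-snoc u j n) ⟩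
  window u j (suc n)                       ∎
  where
  open ≡-Reasoning
  inner : Reflected u (suc s) j n
  inner a b e = trans (ref a (suc b) (trans (+-suc a (suc b)) (cong suc e)))
                      (cong (λ i → not (u i)) (+-suc s b))
  last : not (u s) ≡ u (j + n)
  last = sym (trans (ref n 0 (+-comm n 1)) (cong (λ i → not (u i)) (+-identityʳ s)))

E⇒reflected : ∀ u s j n → E (window u s n) ≡ window u j n → Reflected u s j n
E⇒reflected u s j zero    _  a b e = ⊥-elim (m+1+n≢0 a e)
E⇒reflected u s j (suc n) eq a b e
  with ∷ʳ-injective (E (window u (suc s) n)) (window u j n)
         (trans (sym (E-cons (u s) (window u (suc s) n))) (trans eq (window-snoc u j n)))
... | inner , last with b
...   | zero   = trans (cong (λ i → u (j + i)) a≡n)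
                   (trans (sym last) (cong (λ i → not (u i)) (sym (+-identityʳ s))))
  where
  a≡n : a ≡ n
  a≡n = suc-injective (trans (+-comm 1 a) e)
...   | suc b′ = trans (E⇒reflected u (suc s) j n inner a b′ (suc-injective (trans (sym (+-suc a (suc b′))) e)))
                   (cong (λ i → not (u i)) (sym (+-suc s b′)))

occurrence-antipal : ∀ u s w → window u s (length w) ≡ w → IsAntipalindrome w → AntipalAt u s (length w)
occurrence-antipal u s w occ anti = E⇒reflected u s s _ (subst (λ z → E z ≡ z) (sym occ) anti)

parity : ∀ n → ∃[ h ] (n ≡ h + h ⊎ n ≡ suc (h + h))
parity zero = 0 , inj₁ refl
parity (suc n) with parity n
... | h , inj₁ e = h , inj₂ (cong suc e)
... | h , inj₂ e = suc h , inj₁ (trans (cong suc e) (cong suc (sym (+-suc h h))))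

-- An antipalindrome has even length: an odd one would have a self-complementary middle letter.
antipal-even : ∀ u s n → AntipalAt u s n → ∃[ h ] n ≡ h + h
antipal-even u s n ap with parity n
... | h , inj₁ even = h , even
... | h , inj₂ odd  = ⊥-elim (not-¬ refl (ap h h (trans (+-suc h h) (sym odd))))

-- A factor occurring inside an antipalindromic window u[k..k+L) is mirrored inside it:
-- if it starts a letters after k and ends b letters before k + L, then its
-- exchange-image starts b letters after k.
inside-antipal⇒E-factor : ∀ u k L v → AntipalAt u k L → OccursIn u v k L → IsFactor u (E v)
inside-antipal⇒E-factor u k L v ap (j , k≤j , end≤ , occ)
  with m≤n⇒∃[o]m+o≡n k≤j | m≤n⇒∃[o]m+o≡n end≤
... | a , ka | b , end = subst (IsFactor u) (sym mirror) (window-factor u (k + b) n)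
  where
  n : ℕ
  n = length v
  a+n+b : a + n + b ≡ L
  a+n+b = +-cancelˡ-≡ k _ _ (trans (assoc k a n b) (trans (cong (λ i → i + n + b) ka) end))
    where
    assoc : ∀ k a n b → k + (a + n + b) ≡ k + a + n + b
    assoc = solve-∀
  shuffle : ∀ a b x y → (b + x) + suc (a + y) ≡ a + (x + suc y) + b
  shuffle = solve-∀
  reflected : Reflected u j (k + b) n
  reflected x y e = begin
    u (k + b + x)         ≡⟨ cong u (+-assoc k b x) ⟩
    u (k + (b + x))       ≡⟨ ap (b + x) (a + y) (trans (shuffle a b x y) (trans (cong (λ z → a + z + b) e) a+n+b)) ⟩
    not (u (k + (a + y))) ≡⟨ cong (λ i → not (u i)) (trans (sym (+-assoc k a y)) (cong (_+ y) ka)) ⟩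
    not (u (j + y))       ∎
    where open ≡-Reasoning
  mirror : E v ≡ window u (k + b) n
  mirror = trans (cong E (sym occ)) (reflected⇒E u j (k + b) n reflected)

-- In a uniformly recurrent word with arbitrarily long antipalindromic factors, every
-- factor v sits inside an antipalindromic factor, so the factor set is closed under E.
E-closed : ∀ u → UniformlyRecurrent u → InfinitelyMany (λ w → IsFactor u w × IsAntipalindrome w)
  → ∀ v → IsFactor u v → IsFactor u (E v)
E-closed u ur inf v fv with inf (proj₁ (ur (length v)))
... | W , r≤L , (k , occW) , anti with proj₂ (ur (length v)) k v refl fv
...   | j , k≤j , end≤ , occ =
  inside-antipal⇒E-factor u k (length W) v (occurrence-antipal u k W occW anti)
    (j , k≤j , ≤-trans end≤ (+-monoʳ-≤ k r≤L) , occ)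

Flanked : InfWord → ℕ → ℕ → Set
Flanked u s h = AntipalAt u (suc s) (h + h) × u s ≡ u (suc s + (h + h))

FlankedBeyond : InfWord → ℕ → Set
FlankedBeyond u h = ∃[ s ] ∃[ k ] (h ≤ k × Flanked u s k)

extend-step : ∀ u s n → AntipalAt u (suc s) n → u s ≢ u (suc s + n) → AntipalAt u s (suc (suc n))
extend-step u s n ap ne zero .(suc n) refl =
  trans (cong u (+-identityʳ s)) (trans (¬-not ne) (cong (λ i → not (u i)) (sym (+-suc s n))))
extend-step u s n ap ne (suc a) zero e =
  trans (cong u (trans (+-suc s a) (cong (λ i → suc s + i) a≡n)))
    (trans (¬-not (λ eq → ne (sym eq))) (cong (λ i → not (u i)) (sym (+-identityʳ s))))
  where
  a≡n : a ≡ n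
  a≡n = suc-injective (trans (+-comm 1 a) (suc-injective e))
extend-step u s n ap ne (suc a) (suc b) e rewrite +-suc s a | +-suc s b =
  ap a b (suc-injective (trans (sym (+-suc a (suc b))) (suc-injective e)))

extend-left : ∀ u s h → AntipalAt u s (h + h) → FlankedBeyond u h ⊎ AntipalAt u 0 ((s + h) + (s + h))
extend-left u zero    h ap = inj₂ ap
extend-left u (suc s) h ap with u s ≟ᴮ u (suc s + (h + h))
... | yes eq = inj₁ (s , h , ≤-refl , ap , eq)
... | no ne with extend-left u s (suc h) (subst (AntipalAt u s) (cong suc (sym (+-suc h h))) (extend-step u s (h + h) ap ne))
...   | inj₁ (t , k , h<k , fl) = inj₁ (t , k , ≤-trans (n≤1+n h) h<k , fl)
...   | inj₂ prefix             = inj₂ (subst (λ c → AntipalAt u 0 (c + c)) (+-suc s h) prefix)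

bispecial-by : ∀ u w x → IsFactor u (w ++ [ x ]) → IsFactor u (w ++ [ not x ])
  → IsFactor u (x ∷ w) → IsFactor u (not x ∷ w) → Bispecial u w
bispecial-by u w false wx wx̄ xw x̄w = (wx , wx̄) , (xw , x̄w)
bispecial-by u w true  wx wx̄ xw x̄w = (wx̄ , wx) , (x̄w , xw)

-- If the factor set is E-closed, a flanked antipalindrome w with neighbour x is
-- bispecial: E(wx) = x̄E(w) = x̄w and E(xw) = wx̄.
flanked⇒bispecial : ∀ u s h → (∀ v → IsFactor u v → IsFactor u (E v)) → Flanked u s h
  → Bispecial u (window u (suc s) (h + h))
flanked⇒bispecial u s h closed (ap , flank) = bispecial-by u w x wx wx̄ xw x̄w
  where
  w : Word
  w = window u (suc s) (h + h)
  x : Bool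
  x = u s
  anti : E w ≡ w
  anti = reflected⇒E u (suc s) (suc s) (h + h) ap
  wx : IsFactor u (w ++ [ x ])
  wx = subst (IsFactor u) (trans (window-snoc u (suc s) (h + h)) (cong (λ y → w ++ [ y ]) (sym flank)))
         (window-factor u (suc s) (suc (h + h)))
  xw : IsFactor u (x ∷ w)
  xw = window-factor u s (suc (h + h))
  x̄w : IsFactor u (not x ∷ w)
  x̄w = subst (IsFactor u) (trans (E-snoc w x) (cong (not x ∷_) anti)) (closed _ wx)
  wx̄ : IsFactor u (w ++ [ not x ])
  wx̄ = subst (IsFactor u) (trans (E-cons x w) (cong (_++ [ not x ]) anti)) (closed _ xw)


-- Two antipalindromic prefixes centred at H and H + d: reflecting about H + d and then
-- about H is a translation by 2d, so u has period 2d on the shorter prefix.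
reflections⇒period : ∀ u H d → AntipalAt u 0 (H + H) → AntipalAt u 0 ((H + d) + (H + d))
  → ∀ x → x < H + H → u (x + (d + d)) ≡ u x
reflections⇒period u H d inner outer x x<2H with m≤n⇒∃[o]m+o≡n x<2H
... | b , x+b = trans (outer (x + (d + d)) b outer-sum) (sym (inner x b inner-sum))
  where
  inner-sum : x + suc b ≡ H + H
  inner-sum = trans (+-suc x b) x+b
  shift : ∀ x d b → (x + (d + d)) + suc b ≡ (x + suc b) + (d + d)
  shift = solve-∀
  spread : ∀ H d → (H + H) + (d + d) ≡ (H + d) + (H + d)
  spread = solve-∀
  outer-sum : (x + (d + d)) + suc b ≡ (H + d) + (H + d)
  outer-sum = trans (shift x d b) (trans (cong (_+ (d + d)) inner-sum) (spread H d))

prefix-period⇒periodic : ∀ u p r M → 0 < p → r ≤ M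
  → (∀ i w → length w ≡ suc p → IsFactor u w → OccursIn u w i r)
  → (∀ x → x < M → u (x + p) ≡ u x) → EventuallyPeriodic u
prefix-period⇒periodic u p r M p>0 r≤M occurs period-on-prefix = p , 0 , p>0 , λ n _ → period n
  where
  period : ∀ n → u (n + p) ≡ u n
  period n with occurs 0 (window u n (suc p)) (length-window u n (suc p)) (window-factor u n (suc p))
  ... | j , _ , end≤ , occ = begin
    u (n + p)  ≡⟨ sym (agree p ≤-refl) ⟩
    u (j + p)  ≡⟨ period-on-prefix j j<M ⟩
    u j        ≡⟨ cong u (sym (+-identityʳ j)) ⟩
    u (j + 0)  ≡⟨ agree 0 (s≤s z≤n) ⟩
    u (n + 0)  ≡⟨ cong u (+-identityʳ n) ⟩
    u n        ∎
    where
    open ≡-Reasoning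
    agree : ∀ t → t < suc p → u (j + t) ≡ u (n + t)
    agree = window-≡⇒agree u j n (suc p)
      (subst (λ m → window u j m ≡ window u n (suc p)) (length-window u n (suc p)) occ)
    j<M : j < M
    j<M = ≤-trans (m<m+n j (s≤s z≤n))
            (≤-trans (subst (λ m → j + m ≤ r) (length-window u n (suc p)) end≤) r≤M)

module _ (u : InfWord) (ur : UniformlyRecurrent u) where

  R : ℕ → ℕ
  R n = proj₁ (ur n)

  occurs-within-R : ∀ n i w → length w ≡ n → IsFactor u w → OccursIn u w i (R n)
  occurs-within-R n = proj₂ (ur n)

  Rmax : ℕ → ℕ
  Rmax zero    = R 0
  Rmax (suc k) = R (suc k) + Rmax k

  R≤Rmax : ∀ q k → q ≤ k → R q ≤ Rmax k
  R≤Rmax q zero q≤0 rewrite n≤0⇒n≡0 q≤0 = ≤-refl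
  R≤Rmax q (suc k) q≤k+1 with m≤n⇒m<n∨m≡n q≤k+1
  ... | inj₁ (s≤s q≤k) = ≤-trans (R≤Rmax q k q≤k) (m≤n+m (Rmax k) (R (suc k)))
  ... | inj₂ refl      = m≤m+n (R (suc k)) (Rmax k)

  close-centres⇒periodic : ∀ H d → 0 < d → R (suc (d + d)) ≤ H + H
    → AntipalAt u 0 (H + H) → AntipalAt u 0 ((H + d) + (H + d)) → EventuallyPeriodic u
  close-centres⇒periodic H d d>0 R≤2H inner outer =
    prefix-period⇒periodic u (d + d) _ (H + H) (≤-trans d>0 (m≤m+n d d)) R≤2H
      (occurs-within-R (suc (d + d))) (reflections⇒period u H d inner outer)

  -- A nonempty factor w occurs twice after any position N, at distance 0 < d < 2R(|w|):
  -- once in the window of length R(|w|) at N and once in the next one.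
  two-occurrences : ∀ N w → 0 < length w → IsFactor u w
    → ∃[ j ] ∃[ d ] (N ≤ j × 0 < d × d < R (length w) + R (length w)
                     × window u j (length w) ≡ w × window u (j + d) (length w) ≡ w)
  two-occurrences N w L>0 fw
    with occurs-within-R _ N w refl fw | occurs-within-R _ (N + R (length w)) w refl fw
  ... | j , N≤j , j-end , occ₁ | j′ , N+r≤j′ , j′-end , occ₂
    with m≤n⇒∃[o]m+o≡n (≤-trans (m≤m+n j (length w)) (≤-trans j-end N+r≤j′))
  ... | d , refl = j , d , N≤j , d>0 , d<2r , occ₁ , occ₂
    where
    L r : ℕ
    L = length w
    r = R L
    d>0 : 0 < d
    d>0 = +-cancelˡ-≤ j 1 d (≤-trans (+-monoʳ-≤ j L>0) (≤-trans j-end N+r≤j′))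
    d+L≤2r : d + L ≤ r + r
    d+L≤2r = +-cancelˡ-≤ j (d + L) (r + r) (begin
      j + (d + L)  ≡⟨ sym (+-assoc j d L) ⟩
      j + d + L    ≤⟨ j′-end ⟩
      N + r + r    ≤⟨ +-monoˡ-≤ r (+-monoˡ-≤ r N≤j) ⟩
      j + r + r    ≡⟨ +-assoc j r r ⟩
      j + (r + r)  ∎)
      where open ≤-Reasoning
    d<2r : d < r + r
    d<2r = <-≤-trans (m<m+n d L>0) d+L≤2r

  -- Two occurrences at distance d of an antipalindrome of length 2h, beyond R(2d+1),
  -- yield a flanked antipalindrome of half-length at least h in an aperiodic word:
  -- otherwise both extend to antipalindromic prefixes with centres j + h and j + h + d.
  flanked-from-occurrences : Aperiodic u → ∀ h j d → 0 < d → R (suc (d + d)) ≤ j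
    → AntipalAt u j (h + h) → AntipalAt u (j + d) (h + h) → FlankedBeyond u h
  flanked-from-occurrences aper h j d d>0 R≤j ap₁ ap₂ with extend-left u j h ap₁ | extend-left u (j + d) h ap₂
  ... | inj₁ fl     | _           = fl
  ... | inj₂ _      | inj₁ fl     = fl
  ... | inj₂ inner  | inj₂ outer  = ⊥-elim (aper (close-centres⇒periodic (j + h) d d>0 R≤2H inner
        (subst (λ c → AntipalAt u 0 (c + c)) (swap j d h) outer)))
    where
    swap : ∀ j d h → j + d + h ≡ j + h + d
    swap = solve-∀
    R≤2H : R (suc (d + d)) ≤ (j + h) + (j + h)
    R≤2H = ≤-trans R≤j (≤-trans (m≤m+n j h) (m≤m+n (j + h) (j + h)))

  -- A nonempty antipalindromic factor of length 2h gives a flanked antipalindrome of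
  -- half-length at least h: take two close occurrences of it far enough out.
  flanked-from-antipalindrome : Aperiodic u → ∀ W h → length W ≡ h + h → 0 < length W
    → IsFactor u W → IsAntipalindrome W → FlankedBeyond u h
  flanked-from-antipalindrome aper W h L≡2h L>0 fW anti
    with two-occurrences (Rmax ((R (length W) + R (length W)) + (R (length W) + R (length W)))) W L>0 fW
  ... | j , d , N≤j , d>0 , d<2r , occ₁ , occ₂ =
    flanked-from-occurrences aper h j d d>0 (≤-trans (R≤Rmax _ _ index-bound) N≤j) (at occ₁) (at occ₂)
    where
    index-bound : suc (d + d) ≤ (R (length W) + R (length W)) + (R (length W) + R (length W))
    index-bound = ≤-trans (s≤s (+-monoʳ-≤ d (n≤1+n d))) (+-mono-≤ d<2r d<2r)
    at : ∀ {i} → window u i (length W) ≡ W → AntipalAt u i (h + h)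
    at occ = subst (AntipalAt u _) L≡2h (occurrence-antipal u _ W occ anti)

lemma31 : (u : InfWord) → Aperiodic u → UniformlyRecurrent u
    → InfinitelyMany (λ w → IsFactor u w × IsAntipalindrome w)
    → InfinitelyMany (λ w → IsFactor u w × IsAntipalindrome w × Bispecial u w)
lemma31 u aper ur inf m with inf (suc m)
... | W , m<L , (i , occ) , anti with antipal-even u i (length W) (occurrence-antipal u i W occ anti)
... | h , L≡2h with flanked-from-antipalindrome u ur aper W h L≡2h (≤-trans (s≤s z≤n) m<L) (i , occ) anti
... | s , k , h≤k , fl =
  window u (suc s) (k + k) , long , window-factor u (suc s) (k + k) ,
  reflected⇒E u (suc s) (suc s) (k + k) (proj₁ fl) , flanked⇒bispecial u s k (E-closed u ur inf) fl
  where
  long : m ≤ length (window u (suc s) (k + k))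
  long = ≤-trans (<⇒≤ (subst (m <_) L≡2h m<L))
           (≤-trans (+-mono-≤ h≤k h≤k) (≤-reflexive (sym (length-window u (suc s) (k + k)))))
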